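{- If a $\Sigma$-theory $\mathcal{T}$ is consistent (has at least one interpretation) and has a strong pre-witness with respect to a set $S$ of sorts of $\Sigma$, then $S$ is finite.
   Context: Many-sorted first-order logic with equality; every sort has a non-empty domain in each interpretation. A $\Sigma$-theory $\mathcal{T}$ is the class of $\Sigma$-interpretations satisfying a set of sentences. $\mathrm{QF}(\Sigma)$: quantifier-free formulas; $\mathrm{vars}_\sigma(\varphi)$: free variables of sort $\sigma$; $\top$ denotes truth. For a finite set $V$ of variables and an equivalence relation $E$ on $V$ relating only same-sort variables, the arrangement $\delta_V^E$ is the conjunction of $x=y$ for $xEy$ and $\neg(x=y)$ otherwise. A strong pre-witness w.r.t. $S$ is a (not necessarily computable) function $\mathit{wit}:\mathrm{QF}(\Sigma)\to\mathrm{QF}(\Sigma)$ such that for every $\varphi$: $\varphi$ and $\exists\vec{x}\,\mathit{wit}(\varphi)$ are satisfied by the same $\mathcal{T}$-interpretations, where $\vec{x}=\mathrm{vars}(\mathit{wit}(\varphi))\setminus\mathrm{vars}(\varphi)$; if $\mathit{wit}(\varphi)$ is $\mathcal{T}$-satisfiable, some $\mathcal{T}$-interpretation $\mathcal{A}$ satisfies it with $\sigma^{\mathcal{A}}=\mathrm{vars}_\sigma(\mathit{wit}(\varphi))^{\mathcal{A}}$ for each $\sigma\in S$; and for every finite set $V$ of variables with sorts in $S$ and arrangement $\delta_V$ on $V$, if $\mathit{wit}(\varphi)\wedge\delta_V$ is $\mathcal{T}$-satisfiable then some $\mathcal{T}$-interpretation $\mathcal{A}$ satisfies it with $\sigma^{\mathcal{A}}=\mathrm{vars}_\sigma(\mathit{wit}(\varphi)\wedge\delta_V)^{\mathcal{A}}$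 for each $\sigma\in S$. -}

module Defs where

open import Data.Nat using (ℕ)
open import Data.List using (List; []; _∷_; _++_)
open import Data.List.Relation.Unary.All using (All; []; _∷_)
open import Data.List.Membership.Propositional using (_∈_)
open import Data.Product using (Σ; Σ-syntax; _×_; _,_; proj₁; proj₂)
open import Data.Sum using (_⊎_)
open import Data.Unit using () renaming (⊤ to 𝟙)
open import Data.Empty using () renaming (⊥ to 𝟘)
open import Relation.Nullary using (¬_)
open import Relation.Binary.PropositionalEquality using (_≡_; _≢_)

record Signature : Set₁ where
  field
    Sort    : Set
    Fun     : Set
    Pred    : Set
    funDom  : Fun → List Sort
    funCod  : Fun → Sort
    predDom : Pred → List Sort

module FOL (sig : Signature) where
  open Signature sig public

  FiniteSorts : (Sort → Set) → Set
  FiniteSorts S = Σ[ l ∈ List Sort ] (∀ σ → S σ → σ ∈ l)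

  -- variables: countably many per sort; (σ , n) is the n-th variable of sort σ
  Var : Set
  Var = Sort × ℕ

  data Term : Sort → Set where
    var : ∀ {σ} → ℕ → Term σ
    app : (f : Fun) → All Term (funDom f) → Term (funCod f)

  data Formula : Set where
    ⊤ᶠ ⊥ᶠ      : Formula
    _≐_        : ∀ {σ} → Term σ → Term σ → Formula
    rel        : (p : Pred) → All Term (predDom p) → Formula
    ¬ᶠ_        : Formula → Formula
    _∧ᶠ_ _∨ᶠ_ _⇒ᶠ_ : Formula → Formula → Formula
    ∀ᶠ ∃ᶠ      : Sort → ℕ → Formula → Formula   -- binds the variable (σ , n)

  data IsQF : Formula → Set where
    ⊤q : IsQF ⊤ᶠ
    ⊥q : IsQF ⊥ᶠ
    ≐q : ∀ {σ} (s t : Term σ) → IsQF (s ≐ t)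
    relq : ∀ p ts → IsQF (rel p ts)
    ¬q : ∀ {φ} → IsQF φ → IsQF (¬ᶠ φ)
    ∧q : ∀ {φ ψ} → IsQF φ → IsQF ψ → IsQF (φ ∧ᶠ ψ)
    ∨q : ∀ {φ ψ} → IsQF φ → IsQF ψ → IsQF (φ ∨ᶠ ψ)
    ⇒q : ∀ {φ ψ} → IsQF φ → IsQF ψ → IsQF (φ ⇒ᶠ ψ)

  QF : Set
  QF = Σ Formula IsQF

  data OccT (v : Var) : ∀ {σ} → Term σ → Set
  data OccTs (v : Var) : ∀ {l} → All Term l → Set
  data OccT v where
    here : OccT v (var {proj₁ v} (proj₂ v))
    inApp : ∀ {f ts} → OccTs v ts → OccT v (app f ts)
  data OccTs v where
    hd : ∀ {σ l} {t : Term σ} {ts : All Term l} → OccT v t → OccTs v (t ∷ ts)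
    tl : ∀ {σ l} {t : Term σ} {ts : All Term l} → OccTs v ts → OccTs v (t ∷ ts)

  data Free (v : Var) : Formula → Set where
    ≐ˡ : ∀ {σ} {s t : Term σ} → OccT v s → Free v (s ≐ t)
    ≐ʳ : ∀ {σ} {s t : Term σ} → OccT v t → Free v (s ≐ t)
    relf : ∀ {p ts} → OccTs v ts → Free v (rel p ts)
    ¬f : ∀ {φ} → Free v φ → Free v (¬ᶠ φ)
    ∧ˡ : ∀ {φ ψ} → Free v φ → Free v (φ ∧ᶠ ψ)
    ∧ʳ : ∀ {φ ψ} → Free v ψ → Free v (φ ∧ᶠ ψ)
    ∨ˡ : ∀ {φ ψ} → Free v φ → Free v (φ ∨ᶠ ψ)
    ∨ʳ : ∀ {φ ψ} → Free v ψ → Free v (φ ∨ᶠ ψ)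
    ⇒ˡ : ∀ {φ ψ} → Free v φ → Free v (φ ⇒ᶠ ψ)
    ⇒ʳ : ∀ {φ ψ} → Free v ψ → Free v (φ ⇒ᶠ ψ)
    ∀f : ∀ {σ n φ} → v ≢ (σ , n) → Free v φ → Free v (∀ᶠ σ n φ)
    ∃f : ∀ {σ n φ} → v ≢ (σ , n) → Free v φ → Free v (∃ᶠ σ n φ)

  Sentence : Formula → Set
  Sentence φ = ∀ v → ¬ Free v φ

  -- list of variables occurring in a quantifier-free formula (= its free variables)
  termVars : ∀ {σ} → Term σ → List Var
  termsVars : ∀ {l} → All Term l → List Var
  termVars {σ} (var n) = (σ , n) ∷ []
  termVars (app f ts) = termsVars ts
  termsVars [] = []
  termsVars (t ∷ ts) = termVars t ++ termsVars ts

  occVars : Formula → List Var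
  occVars ⊤ᶠ = []
  occVars ⊥ᶠ = []
  occVars (s ≐ t) = termVars s ++ termVars t
  occVars (rel p ts) = termsVars ts
  occVars (¬ᶠ φ) = occVars φ
  occVars (φ ∧ᶠ ψ) = occVars φ ++ occVars ψ
  occVars (φ ∨ᶠ ψ) = occVars φ ++ occVars ψ
  occVars (φ ⇒ᶠ ψ) = occVars φ ++ occVars ψ
  occVars (∀ᶠ σ n φ) = occVars φ
  occVars (∃ᶠ σ n φ) = occVars φ

  vars : QF → List Var
  vars φ = occVars (proj₁ φ)

  record Structure : Set₁ where
    field
      dom       : Sort → Set
      inhabited : (σ : Sort) → dom σ
      funᴵ      : (f : Fun) → All dom (funDom f) → dom (funCod f)
      predᴵ     : (p : Pred) → All dom (predDom p) → Set

  open Structure public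

  -- variable assignment (an interpretation in the paper's sense is a
  -- structure together with an assignment)
  Assignment : Structure → Set
  Assignment A = (σ : Sort) → ℕ → dom A σ

  module _ (A : Structure) where
    evalT : ∀ {σ} → Assignment A → Term σ → dom A σ
    evalTs : ∀ {l} → Assignment A → All Term l → All (dom A) l
    evalT {σ} ρ (var n) = ρ σ n
    evalT ρ (app f ts) = funᴵ A f (evalTs ρ ts)
    evalTs ρ [] = []
    evalTs ρ (t ∷ ts) = evalT ρ t ∷ evalTs ρ ts

    Variant : Var → Assignment A → Assignment A → Set
    Variant v ρ' ρ = ∀ w → w ≢ v → ρ' (proj₁ w) (proj₂ w) ≡ ρ (proj₁ w) (proj₂ w)

    Sat : Assignment A → Formula → Set
    Sat ρ ⊤ᶠ = 𝟙
    Sat ρ ⊥ᶠ = 𝟘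
    Sat ρ (s ≐ t) = evalT ρ s ≡ evalT ρ t
    Sat ρ (rel p ts) = predᴵ A p (evalTs ρ ts)
    Sat ρ (¬ᶠ φ) = ¬ Sat ρ φ
    Sat ρ (φ ∧ᶠ ψ) = Sat ρ φ × Sat ρ ψ
    Sat ρ (φ ∨ᶠ ψ) = Sat ρ φ ⊎ Sat ρ ψ
    Sat ρ (φ ⇒ᶠ ψ) = Sat ρ φ → Sat ρ ψ
    Sat ρ (∀ᶠ σ n φ) = ∀ ρ' → Variant (σ , n) ρ' ρ → Sat ρ' φ
    Sat ρ (∃ᶠ σ n φ) = Σ[ ρ' ∈ Assignment A ] (Variant (σ , n) ρ' ρ × Sat ρ' φ)

    -- (A, ρ) ⊨ ∃x⃗ ψ  where  x⃗ = vars(ψ) ∖ vars(φ)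
    SatExistsNew : Assignment A → (φ ψ : QF) → Set
    SatExistsNew ρ φ ψ =
      Σ[ ρ' ∈ Assignment A ]
        ((∀ v → ¬ (v ∈ vars ψ × ¬ v ∈ vars φ) →
               ρ' (proj₁ v) (proj₂ v) ≡ ρ (proj₁ v) (proj₂ v))
         × Sat ρ' (proj₁ ψ))

    -- σ^A = X_σ^A  for the variables of sort σ in the list X
    DomainIsVars : Assignment A → Sort → List Var → Set
    DomainIsVars ρ σ X = ∀ (a : dom A σ) → Σ[ n ∈ ℕ ] ((σ , n) ∈ X × ρ σ n ≡ a)

  record Theory : Set₁ where
    field
      Ax        : Formula → Set
      axClosed  : ∀ φ → Ax φ → Sentence φ

  open Theory public

  IsModel : Theory → Structure → Set
  IsModel T A = ∀ φ → Ax T φ → ∀ ρ → Sat A ρ φ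

  Consistent : Theory → Set₁
  Consistent T = Σ[ A ∈ Structure ] IsModel T A

  -- Arrangements δ_V^E (given semantically: satisfaction of the conjunction)

  record EquivOn (V : List Var) : Set₁ where
    field
      E        : Var → Var → Set
      inV      : ∀ {x y} → E x y → x ∈ V × y ∈ V
      sameSort : ∀ {x y} → E x y → proj₁ x ≡ proj₁ y
      reflOn   : ∀ {x} → x ∈ V → E x x
      symm     : ∀ {x y} → E x y → E y x
      trans    : ∀ {x y z} → E x y → E y z → E x z

  open EquivOn public

  SatArr : (A : Structure) → Assignment A → (V : List Var) → EquivOn V → Set
  SatArr A ρ V Eq = ∀ σ m n → (σ , m) ∈ V → (σ , n) ∈ V →
      (E Eq (σ , m) (σ , n) → ρ σ m ≡ ρ σ n)
    × (¬ E Eq (σ , m) (σ , n) → ¬ ρ σ m ≡ ρ σ n)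

  record StrongPreWitness (T : Theory) (S : Sort → Set) (wit : QF → QF) : Set₁ where
    field
      equiv : ∀ (φ : QF) (A : Structure) → IsModel T A → (ρ : Assignment A) →
        (Sat A ρ (proj₁ φ) → SatExistsNew A ρ φ (wit φ))
        × (SatExistsNew A ρ φ (wit φ) → Sat A ρ (proj₁ φ))
      minimal : ∀ (φ : QF) →
        (Σ[ A ∈ Structure ] (IsModel T A × Σ[ ρ ∈ Assignment A ] Sat A ρ (proj₁ (wit φ)))) →
        Σ[ A ∈ Structure ] (IsModel T A × Σ[ ρ ∈ Assignment A ]
          (Sat A ρ (proj₁ (wit φ)) × (∀ σ → S σ → DomainIsVars A ρ σ (vars (wit φ)))))
      minimalArr : ∀ (φ : QF) (V : List Var) → All (λ v → S (proj₁ v)) V → (Eq : EquivOn V) →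
        (Σ[ A ∈ Structure ] (IsModel T A × Σ[ ρ ∈ Assignment A ]
          (Sat A ρ (proj₁ (wit φ)) × SatArr A ρ V Eq))) →
        Σ[ A ∈ Structure ] (IsModel T A × Σ[ ρ ∈ Assignment A ]
          ((Sat A ρ (proj₁ (wit φ)) × SatArr A ρ V Eq)
           × (∀ σ → S σ → DomainIsVars A ρ σ (vars (wit φ) ++ V))))

{-# OPTIONS --safe #-}
module Submission where

-- Every model satisfies ⊤, so wit(⊤) is satisfiable, and minimality gives a
-- model in which each domain of a sort in S is enumerated by variables of
-- wit(⊤). Domains are non-empty, so every sort of S is the sort of one of the
-- finitely many variables of wit(⊤).

open import Defs
open import Data.List using (List; map)
open import Data.List.Membership.Propositional using (_∈_)
open import Data.List.Membership.Propositional.Properties using (∈-map⁺)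
open import Data.Product using (Σ-syntax; _×_; _,_; proj₁; proj₂)
open import Data.Unit using (tt)

module _ {sig : Signature} where
  open FOL sig

  Satisfiable : Theory → Formula → Set₁
  Satisfiable T φ = Σ[ A ∈ Structure ] (IsModel T A × Σ[ ρ ∈ Assignment A ] Sat A ρ φ)

  sorts : List Var → List Sort
  sorts = map proj₁

  DomainIsVars⇒∈sorts : ∀ {A : Structure} {ρ : Assignment A} {σ X} →
    DomainIsVars A ρ σ X → σ ∈ sorts X
  DomainIsVars⇒∈sorts {A} {σ = σ} covered =
    ∈-map⁺ proj₁ (proj₁ (proj₂ (covered (inhabited A σ))))

  satisfiable⇒wit-satisfiable : ∀ {T S wit} → StrongPreWitness T S wit →
    ∀ φ → Satisfiable T (proj₁ φ) → Satisfiable T (proj₁ (wit φ))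
  satisfiable⇒wit-satisfiable spw φ (A , isModel , ρ , sat)
    with ρ′ , _ , sat′ ← proj₁ (StrongPreWitness.equiv spw φ A isModel ρ) sat
    = A , isModel , ρ′ , sat′

  wit-satisfiable⇒finiteSorts : ∀ {T S wit} → StrongPreWitness T S wit →
    ∀ φ → Satisfiable T (proj₁ (wit φ)) → FiniteSorts S
  wit-satisfiable⇒finiteSorts {wit = wit} spw φ satisfiable
    with A , _ , ρ , _ , covered ← StrongPreWitness.minimal spw φ satisfiable
    = sorts (vars (wit φ)) , λ σ σ∈S → DomainIsVars⇒∈sorts {A} {ρ} (covered σ σ∈S)

proposition1 : (sig : Signature) → let open FOL sig in
    (T : Theory) (S : Sort → Set) → Consistent T →
    (wit : QF → QF) → StrongPreWitness T S wit → FiniteSorts S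
proposition1 sig T S (A , isModel) wit spw =
  wit-satisfiable⇒finiteSorts spw ⊤QF
    (satisfiable⇒wit-satisfiable spw ⊤QF (A , isModel , (λ σ _ → inhabited A σ) , tt))
  where
  open FOL sig
  ⊤QF : QF
  ⊤QF = ⊤ᶠ , ⊤q
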